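{- If $A,B\subset\mathbb{N}$ are practical sets, then $AB=\{ab: a\in A,\ b\in B\}$ is practical.
   Context: $\mathbb{N}=\{1,2,3,\dots\}$. For $A\subset\mathbb{N}$, $S_A=\sum_{a\in A}a$ (with $S_\emptyset=0$; $S_A=+\infty$ if $A$ is infinite). A set $A\subset\mathbb{N}$ is called practical if every non-negative integer $k\le S_A$ can be written as a sum of distinct elements of $A$ (the empty sum equals $0$). -}

module Defs where

open import Level using (0ℓ)
open import Data.Nat using (ℕ; _≤_; _*_)
open import Data.List using (List)
open import Data.Nat.ListAction using (sum)
open import Data.List.Relation.Unary.All using (All)
open import Data.List.Relation.Unary.Unique.Propositional using (Unique)
open import Data.Product using (Σ; _×_; ∃; ∃-syntax)
open import Relation.Binary.PropositionalEquality using (_≡_)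
open import Relation.Unary using (Pred)

-- A subset of ℕ is a predicate; the statement separately requires
-- all elements to be positive (subsets of {1,2,3,...}).
SubsetN : Set₁
SubsetN = Pred ℕ 0ℓ

Positive : SubsetN → Set
Positive A = ∀ a → A a → 1 ≤ a

FinSub : SubsetN → List ℕ → Set
FinSub A F = Unique F × All A F

IsDistinctSum : SubsetN → ℕ → Set
IsDistinctSum A k = ∃[ F ] (FinSub A F × sum F ≡ k)

-- k ≤ S_A, where S_A = sup of sums of finite subsets of A (= +∞ if A infinite)
LeSum : ℕ → SubsetN → Set
LeSum k A = ∃[ F ] (FinSub A F × k ≤ sum F)

Practical : SubsetN → Set
Practical A = ∀ k → LeSum k A → IsDistinctSum A k

ProdSet : SubsetN → SubsetN → SubsetN
ProdSet A B n = ∃[ a ] ∃[ b ] (A a × B b × n ≡ a * b)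

-- A set C is practical iff every n below an element c ∈ C is a sum of distinct elements
-- of C below c.  For the harder direction, list a finite F ⊆ C with k ≤ S_F in
-- decreasing order, c first: if k < c this is the hypothesis, otherwise write k − c
-- from the rest of F, all of whose elements lie below c, and add c.
-- For a ∈ A, b ∈ B and n < ab, divide n = qb + r with q < a and r < b, and write
-- q = Σ aᵢ with distinct aᵢ < a in A and r = Σ bⱼ with distinct bⱼ < b in B.  Then
-- n = Σ aᵢb + Σ 1·bⱼ is a sum of distinct elements of AB below ab, as aᵢb ≥ b > bⱼ
-- and 1 ∈ A.
module Submission where

open import Defs
open import Data.Nat using (ℕ; s≤s; _+_; _*_; _∸_; _≤_; _<_; _>_; _<?_; NonZero; >-nonZero)
open import Data.Nat.Properties
open import Data.Nat.DivMod using (_/_; _%_; m≡m%n+[m/n]*n; m%n<n; m<n*o⇒m/o<n)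
open import Data.List using ([]; _∷_; map; _++_)
open import Data.Nat.ListAction using (sum)
open import Data.Nat.ListAction.Properties using (sum-++; sum-↭)
open import Data.List.Relation.Unary.All as All using (All; []; _∷_)
import Data.List.Relation.Unary.All.Properties as All
open import Data.List.Relation.Unary.AllPairs as AllPairs using (AllPairs; []; _∷_)
open import Data.List.Relation.Unary.Linked.Properties using (Linked⇒AllPairs)
open import Data.List.Relation.Unary.Unique.Propositional using (Unique)
import Data.List.Relation.Unary.Unique.Propositional.Properties as Unique
open import Data.List.Relation.Binary.Permutation.Propositional using (_↭_; ↭-sym; ↭⇒↭ₛ)
open import Data.List.Relation.Binary.Permutation.Propositional.Properties using (All-resp-↭)
import Data.List.Relation.Binary.Permutation.Setoid.Properties as Permutationₛ
open import Relation.Binary.Properties.DecTotalOrder ≤-decTotalOrder using (≥-decTotalOrder)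
open import Data.List.Sort ≥-decTotalOrder using (sort; sort-↭; sort-↗)
open import Data.List.Membership.Propositional using (_∈_)
open import Data.Product using (∃-syntax; _×_; _,_)
open import Data.Sum using (inj₁; inj₂)
open import Relation.Nullary using (¬_; yes; no)
open import Function using (_∘_)
open import Relation.Binary.PropositionalEquality
  using (_≡_; refl; sym; trans; cong; cong₂; subst; setoid; module ≡-Reasoning)

All-≤-sum : ∀ xs → All (_≤ sum xs) xs
All-≤-sum []       = []
All-≤-sum (x ∷ xs) = m≤m+n x (sum xs) ∷ All.map (λ y≤ → ≤-trans y≤ (m≤n+m (sum xs) x)) (All-≤-sum xs)

sum-map-*ʳ : ∀ b xs → sum (map (_* b) xs) ≡ sum xs * b
sum-map-*ʳ b []       = refl
sum-map-*ʳ b (x ∷ xs) = trans (cong (x * b +_) (sum-map-*ʳ b xs)) (sym (*-distribʳ-+ b x (sum xs)))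

++-unique-separated : ∀ {b xs ys} → Unique xs → Unique ys →
                      All (_< b) xs → All (b ≤_) ys → Unique (xs ++ ys)
++-unique-separated {b} {xs} {ys} uxs uys xs<b b≤ys = Unique.++⁺ uxs uys disjoint
  where
  disjoint : ∀ {v} → ¬ (v ∈ xs × v ∈ ys)
  disjoint (v∈xs , v∈ys) = <⇒≱ (All.lookup xs<b v∈xs) (All.lookup b≤ys v∈ys)

decreasing-↭ : ∀ {xs} → Unique xs → ∃[ ys ] (ys ↭ xs × AllPairs _>_ ys)
decreasing-↭ {xs} uxs = sort xs , sort-↭ xs ,
  AllPairs.zipWith (λ (y≥z , y≢z) → ≤∧≢⇒< y≥z (y≢z ∘ sym))
    (Linked⇒AllPairs (λ x≥y y≥z → ≤-trans y≥z x≥y) (sort-↗ xs) , unique-sorted)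
  where
  unique-sorted : Unique (sort xs)
  unique-sorted = Permutationₛ.Unique-resp-↭ (setoid ℕ) (↭⇒↭ₛ (↭-sym (sort-↭ xs))) uxs

DistinctSumBelow : SubsetN → ℕ → ℕ → Set
DistinctSumBelow C m n = ∃[ G ] (FinSub C G × All (_< m) G × sum G ≡ n)

SumsBelowEachElement : SubsetN → Set
SumsBelowEachElement C = ∀ {c n} → C c → n < c → DistinctSumBelow C c n

module _ {C : SubsetN} where

  distinctSumBelow-mono : ∀ {m m′ n} → m ≤ m′ → DistinctSumBelow C m n → DistinctSumBelow C m′ n
  distinctSumBelow-mono m≤m′ (G , fG , G<m , sG) = G , fG , All.map (λ x<m → <-≤-trans x<m m≤m′) G<m , sG

  distinctSumBelow-∷ : ∀ {x m n} → C x → x < m → DistinctSumBelow C x n → DistinctSumBelow C m (x + n)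
  distinctSumBelow-∷ {x} Cx x<m (G , (uG , CG) , G<x , sG) =
    x ∷ G , (All.map (λ y<x x≡y → <-irrefl (sym x≡y) y<x) G<x ∷ uG , Cx ∷ CG) ,
    x<m ∷ All.map (λ y<x → <-trans y<x x<m) G<x , cong (x +_) sG

  module _ (sums : SumsBelowEachElement C) where

    distinctSumBelow-decreasing : ∀ {F m k} → AllPairs _>_ F → All C F → All (_< m) F →
                                  k ≤ sum F → DistinctSumBelow C m k
    distinctSumBelow-decreasing {[]} [] [] [] k≤0 rewrite n≤0⇒n≡0 k≤0 = [] , ([] , []) , [] , refl
    distinctSumBelow-decreasing {x ∷ F} {m} {k} (F<x ∷ dec) (Cx ∷ CF) (x<m ∷ _) k≤ with k <? x
    ... | yes k<x = distinctSumBelow-mono (<⇒≤ x<m) (sums Cx k<x)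
    ... | no k≮x = subst (DistinctSumBelow C m) (m+[n∸m]≡n (≮⇒≥ k≮x))
          (distinctSumBelow-∷ Cx x<m (distinctSumBelow-decreasing dec CF F<x rest≤))
      where
      rest≤ : k ∸ x ≤ sum F
      rest≤ = subst (k ∸ x ≤_) (m+n∸m≡n x (sum F)) (∸-monoˡ-≤ x k≤)

    sumsBelowEachElement⇒practical : Practical C
    sumsBelowEachElement⇒practical k (F , (uF , CF) , k≤) =
      let D , D↭F , decD = decreasing-↭ uF
          sD≡sF = sum-↭ D↭F
          G , fG , _ , sG = distinctSumBelow-decreasing decD (All-resp-↭ (↭-sym D↭F) CF)
                              (All.map s≤s (All-≤-sum D)) (subst (k ≤_) (sym sD≡sF) k≤)
      in G , fG , sG

  practical⇒sumsBelowEachElement : Practical C → SumsBelowEachElement C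
  practical⇒sumsBelowEachElement practical {c} {n} Cc n<c =
    let G , fG , sG = practical n (c ∷ [] , ([] ∷ [] , Cc ∷ []) , subst (n ≤_) (sym (+-identityʳ c)) (<⇒≤ n<c))
    in G , fG , All.map (λ x≤ → ≤-<-trans (subst (_ ≤_) sG x≤) n<c) (All-≤-sum G) , sG

  sumsBelowEachElement⇒1∈ : Positive C → SumsBelowEachElement C → ∀ {c} → C c → C 1
  sumsBelowEachElement⇒1∈ positive sums {c} Cc with m≤n⇒m<n∨m≡n (positive c Cc)
  ... | inj₂ 1≡c = subst C (sym 1≡c) Cc
  ... | inj₁ 1<c with sums Cc 1<c
  ...   | x ∷ G , (_ , Cx ∷ _) , _ , sG =
          subst C (≤-antisym (subst (x ≤_) sG (m≤m+n x (sum G))) (positive x Cx)) Cx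

module _ {A B : SubsetN} (positiveA : Positive A) where

  distinctSumBelow-digits : ∀ {a b q r} .{{_ : NonZero a}} .{{_ : NonZero b}} → A 1 → B b →
                            DistinctSumBelow A a q → DistinctSumBelow B b r →
                            DistinctSumBelow (ProdSet A B) (a * b) (r + q * b)
  distinctSumBelow-digits {a} {b} {q} {r} A1 Bb (H , (uH , AH) , H<a , sH) (L , (uL , BL) , L<b , sL) =
    L ++ map (_* b) H , (unique , members) , bounded , summed
    where
    unique : Unique (L ++ map (_* b) H)
    unique = ++-unique-separated uL (Unique.map⁺ (λ {x} {y} → *-cancelʳ-≡ x y b) uH) L<b
               (All.map⁺ (All.map (λ {x} Ax → m≤n*m b x {{>-nonZero (positiveA x Ax)}}) AH))

    members : All (ProdSet A B) (L ++ map (_* b) H)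
    members = All.++⁺ (All.map (λ {y} By → 1 , y , A1 , By , sym (*-identityˡ y)) BL)
                      (All.map⁺ (All.map (λ {x} Ax → x , b , Ax , Bb , refl) AH))

    bounded : All (_< a * b) (L ++ map (_* b) H)
    bounded = All.++⁺ (All.map (λ y<b → <-≤-trans y<b (m≤n*m b a)) L<b)
                      (All.map⁺ (All.map (*-monoˡ-< b) H<a))

    summed : sum (L ++ map (_* b) H) ≡ r + q * b
    summed = begin
      sum (L ++ map (_* b) H)     ≡⟨ sum-++ L (map (_* b) H) ⟩
      sum L + sum (map (_* b) H)  ≡⟨ cong₂ _+_ sL (trans (sum-map-*ʳ b H) (cong (_* b) sH)) ⟩
      r + q * b                   ∎
      where open ≡-Reasoning

  sumsBelowEachElement-ProdSet : Positive B → SumsBelowEachElement A → SumsBelowEachElement B →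
                                 SumsBelowEachElement (ProdSet A B)
  sumsBelowEachElement-ProdSet positiveB sumsA sumsB (a , b , Aa , Bb , refl) =
    divide Aa Bb {{>-nonZero (positiveA a Aa)}} {{>-nonZero (positiveB b Bb)}}
    where
    divide : ∀ {a b n} → A a → B b → .{{NonZero a}} → .{{NonZero b}} →
             n < a * b → DistinctSumBelow (ProdSet A B) (a * b) n
    divide {a} {b} {n} Aa Bb n<ab =
      subst (DistinctSumBelow (ProdSet A B) (a * b)) (sym (m≡m%n+[m/n]*n n b))
        (distinctSumBelow-digits (sumsBelowEachElement⇒1∈ positiveA sumsA Aa) Bb
          (sumsA Aa (m<n*o⇒m/o<n n<ab)) (sumsB Bb (m%n<n n b)))

corollary2p17 : (A B : SubsetN) → Positive A → Positive B →
    Practical A → Practical B → Practical (ProdSet A B)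
corollary2p17 A B positiveA positiveB practicalA practicalB =
  sumsBelowEachElement⇒practical
    (sumsBelowEachElement-ProdSet positiveA positiveB
      (practical⇒sumsBelowEachElement practicalA) (practical⇒sumsBelowEachElement practicalB))
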